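{- Let $H=(V,E)$ be a connected hypergraph without empty edges, and $v\in V$. Then $v$ is a separating vertex of $H$ if and only if $v$ lies in more than one block of $H$.
   Context: A hypergraph $H=(V,E)$ consists of a nonempty finite vertex set $V$, a finite edge set $E$, and an incidence function $\psi:E\to 2^V$; edges are identified with their vertex sets (parallel edges allowed); an empty edge has empty vertex set. Two distinct vertices are adjacent via $e$ if both lie in $e$; a walk is a sequence $v_0e_1v_1\dots e_kv_k$ with $v_{i-1},v_i$ adjacent via $e_i$; $H$ is connected if any two distinct vertices are joined by a walk. A hypersubgraph of $H$ is a hypergraph $(V',E')$ with $\emptyset\ne V'\subseteq V$, $E'\subseteq E$. A vertex $v$ is a separating vertex of a connected hypergraph $K$ without empty edges if there are two connected hypersubgraphs $K_1,K_2$ of $K$, each with at least one edge, with $E(K_1)\cap E(K_2)=\emptyset$, $V(K)=V(K_1)\cup V(K_2)$, $E(K)=E(K_1)\cup E(K_2)$, and $V(K_1)\cap V(K_2)=\{v\}$. A hypergraph is non-separable if it is connected, has no empty edges and has no separating vertices. A block of $H$ is a maximal non-separable hypersubgraph of $H$. -}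

module Defs where

open import Data.Nat using (ℕ; suc)
open import Data.Fin using (Fin)
open import Data.Fin.Subset using (Subset; _∈_; _⊆_; Nonempty; ⊤)
open import Data.Product using (_×_; Σ; ∃; ∃-syntax; _,_)
open import Data.Sum using (_⊎_)
open import Data.Empty using (⊥)
open import Relation.Nullary using (¬_)
open import Relation.Binary.PropositionalEquality using (_≡_; _≢_)

-- A finite hypergraph: vertex set Fin (suc k) (nonempty), edge set Fin m
-- (parallel edges allowed since different edge labels may have equal
-- vertex sets), incidence function ψ : E → 2^V.
record Hypergraph : Set where
  field
    k : ℕ
    m : ℕ
    ψ : Fin m → Subset (suc k)

  V : Set
  V = Fin (suc k)

  E : Set
  E = Fin m

open Hypergraph public

record Sub (H : Hypergraph) : Set where
  constructor sub
  field
    VS : Subset (suc (k H))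
    ES : Subset (m H)

open Sub public

IsHypersubgraph : (H : Hypergraph) → Sub H → Set
IsHypersubgraph H K =
  Nonempty (VS K) × (∀ (e : E H) → e ∈ ES K → ψ H e ⊆ VS K)

_≤ₛ_ : {H : Hypergraph} → Sub H → Sub H → Set
K' ≤ₛ K = (VS K' ⊆ VS K) × (ES K' ⊆ ES K)

data Walk {H : Hypergraph} (K : Sub H) : V H → V H → Set where
  [] : ∀ {u} → Walk K u u
  step : ∀ {u x w} (e : E H) → e ∈ ES K → u ∈ ψ H e → x ∈ ψ H e → u ≢ x →
         Walk K x w → Walk K u w

Connected : {H : Hypergraph} → Sub H → Set
Connected K = ∀ u w → u ∈ VS K → w ∈ VS K → u ≢ w → Walk K u w

NoEmptyEdges : {H : Hypergraph} → Sub H → Set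
NoEmptyEdges {H} K = ∀ (e : E H) → e ∈ ES K → Nonempty (ψ H e)

HasEdge : {H : Hypergraph} → Sub H → Set
HasEdge {H} K = ∃[ e ] e ∈ ES K

Separating : {H : Hypergraph} → Sub H → V H → Set
Separating {H} K v = Σ (Sub H) λ K₁ → Σ (Sub H) λ K₂ →
    IsHypersubgraph H K₁ × IsHypersubgraph H K₂
  × K₁ ≤ₛ K × K₂ ≤ₛ K
  × Connected K₁ × Connected K₂
  × HasEdge K₁ × HasEdge K₂
  × (∀ (e : E H) → e ∈ ES K₁ → e ∈ ES K₂ → ⊥)
  × (∀ (x : V H) → x ∈ VS K → x ∈ VS K₁ ⊎ x ∈ VS K₂)
  × (∀ (e : E H) → e ∈ ES K → e ∈ ES K₁ ⊎ e ∈ ES K₂)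
  × (∀ (x : V H) → x ∈ VS K₁ → x ∈ VS K₂ → x ≡ v)
  × v ∈ VS K₁ × v ∈ VS K₂

NonSeparable : {H : Hypergraph} → Sub H → Set
NonSeparable K = Connected K × NoEmptyEdges K × (∀ v → ¬ Separating K v)

IsBlock : (H : Hypergraph) → Sub H → Set
IsBlock H B = IsHypersubgraph H B × NonSeparable B
  × (∀ (K : Sub H) → IsHypersubgraph H K → NonSeparable K → B ≤ₛ K → K ≤ₛ B)

whole : (H : Hypergraph) → Sub H
whole H = sub ⊤ ⊤

Distinct : {H : Hypergraph} → Sub H → Sub H → Set
Distinct K K' = ¬ (VS K ≡ VS K' × ES K ≡ ES K')

InMoreThanOneBlock : (H : Hypergraph) → V H → Set
InMoreThanOneBlock H v = Σ (Sub H) λ B₁ → Σ (Sub H) λ B₂ →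
  IsBlock H B₁ × IsBlock H B₂ × Distinct B₁ B₂ × v ∈ VS B₁ × v ∈ VS B₂

{-# OPTIONS --safe #-}
module Submission where

open import Defs
open import Data.Nat using (ℕ; _+_; _≤_; _<_; _<?_)
open import Data.Nat.Properties using (≮⇒≥; <⇒≱; +-mono-<-≤; +-mono-≤-<)
open import Data.Nat.Induction using (<-wellFounded)
open import Induction.WellFounded using (Acc; acc)
open import Data.Fin using (Fin; _≟_)
open import Data.Fin.Subset
  using (Subset; _∈_; _∉_; _⊆_; Nonempty; ∁; _∩_; _∪_; ⁅_⁆; ∣_∣)
open import Data.Fin.Subset.Properties
open import Data.Fin.Properties using (any?; all?)
open import Data.List using (List; []; _∷_; allFin)
import Data.List.Membership.Propositional as List
open import Data.List.Membership.Propositional.Properties using (∈-allFin)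
open import Data.List.Relation.Unary.Any using (here; there)
open import Data.Product using (_×_; ∃; _,_; proj₁; proj₂; map₂)
open import Data.Sum using (_⊎_; inj₁; inj₂; [_,_]′)
import Data.Sum as Sum
open import Data.Empty using (⊥; ⊥-elim)
open import Function using (_∘_; id)
open import Relation.Nullary using (¬_; Dec; yes; no)
open import Relation.Nullary.Decidable
  using (_×-dec_; _⊎-dec_; _→-dec_; ¬?; map′; decidable-stable)
open import Relation.Binary.PropositionalEquality
  using (_≡_; _≢_; refl; sym; subst)

-- A non-separable K inside a hypergraph M separated at w lies in one part: if K had an edge in
-- each part, intersecting the parts with K would separate K at w, because a walk in K from one
-- part to the other passes through w. So if v separates H, blocks through edges at v on the two
-- sides differ. Conversely, let v lie in blocks B₁ ≠ B₂ without separating H, and take a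
-- connected M ⊇ B₁ ∪ B₂ not separated at v with fewest edges. If some w ≠ v separated M, both
-- blocks would lie in one part (otherwise w = v), and that part would be a smaller such M, since
-- a separation of it at v extends to one of M. So M is non-separable and maximality gives
-- B₁ = M = B₂. (If v lies in no edge, connectivity makes v the only vertex and H edgeless.)
-- Everything is finite, hence decidable, which makes the extremal choices constructive.

⊆⊎∃∉ : ∀ {n} (p q : Subset n) → p ⊆ q ⊎ ∃ λ x → x ∈ p × x ∉ q
⊆⊎∃∉ p q with any? (λ x → (x ∈? p) ×-dec ¬? (x ∈? q))
... | yes x∈p∖q = inj₂ x∈p∖q
... | no p∖q-empty = inj₁ λ {x} x∈p →
  decidable-stable (x ∈? q) (λ x∉q → p∖q-empty (x , x∈p , x∉q))

regroup-∪ : ∀ {n} {s s₁ s₂ t : Subset n} {x} →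
  (x ∈ s → x ∈ s₁ ⊎ x ∈ s₂) → x ∈ s ⊎ x ∈ t → x ∈ s₁ ∪ t ⊎ x ∈ s₂
regroup-∪ split (inj₁ x∈s) = Sum.map₁ (x∈p∪q⁺ ∘ inj₁) (split x∈s)
regroup-∪ split (inj₂ x∈t) = inj₁ (x∈p∪q⁺ (inj₂ x∈t))

∈-∩-split : ∀ {n} {p q r : Subset n} {x} →
  x ∈ p → x ∈ q ⊎ x ∈ r → x ∈ p ∩ q ⊎ x ∈ p ∩ r
∈-∩-split x∈p = Sum.map (λ x∈q → x∈p∩q⁺ (x∈p , x∈q)) (λ x∈r → x∈p∩q⁺ (x∈p , x∈r))

module _ {A : Set} (μ : A → ℕ) {P : A → Set}
         (smaller? : ∀ a → Dec (∃ λ b → P b × μ b < μ a)) where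

  μ-minimal : ∀ {a} → P a → ∃ λ b → P b × ∀ c → P c → μ b ≤ μ c
  μ-minimal {a} Pa = descend Pa (<-wellFounded (μ a))
    where
    descend : ∀ {a} → P a → Acc _<_ (μ a) → ∃ λ b → P b × ∀ c → P c → μ b ≤ μ c
    descend {a} Pa (acc below) with smaller? a
    ... | yes (b , Pb , b<a) = descend Pb (below b<a)
    ... | no none = a , Pa , λ c Pc → ≮⇒≥ λ c<a → none (c , Pc , c<a)

-- Floyd–Warshall: R-paths whose intermediate vertices lie in L, decided by induction on L.
module Reachability {n : ℕ} {R : Fin n → Fin n → Set} (R? : ∀ u w → Dec (R u w)) where

  data Path (L : List (Fin n)) : Fin n → Fin n → Set where
    edge : ∀ {u w} → R u w → Path L u w
    via  : ∀ {u x w} → R u x → x List.∈ L → Path L x w → Path L u w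

  weaken : ∀ {t L u w} → Path L u w → Path (t ∷ L) u w
  weaken (edge r) = edge r
  weaken (via r x∈L p) = via r (there x∈L) (weaken p)

  join : ∀ {L u t w} → Path L u t → t List.∈ L → Path L t w → Path L u w
  join (edge r) t∈L q = via r t∈L q
  join (via r x∈L p) t∈L q = via r x∈L (join p t∈L q)

  split : ∀ {t L u w} → Path (t ∷ L) u w → Path L u w ⊎ (Path L u t × Path L t w)
  split (edge r) = inj₁ (edge r)
  split (via r (here refl) p) with split p
  ... | inj₁ q = inj₂ (edge r , q)
  ... | inj₂ (_ , q) = inj₂ (edge r , q)
  split (via r (there x∈L) p) with split p
  ... | inj₁ q = inj₁ (via r x∈L q)
  ... | inj₂ (q₁ , q₂) = inj₂ (via r x∈L q₁ , q₂)

  path? : ∀ L u w → Dec (Path L u w)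
  path? [] u w = map′ edge (λ { (edge r) → r ; (via _ () _) }) (R? u w)
  path? (t ∷ L) u w =
    map′ [ weaken , (λ (p , q) → join (weaken p) (here refl) (weaken q)) ]′ split
         (path? L u w ⊎-dec (path? L u t ×-dec path? L t w))

module _ {H : Hypergraph} where

  EdgeClosed : Sub H → Set
  EdgeClosed K = ∀ e → e ∈ ES K → ψ H e ⊆ VS K

  Adjacent : Sub H → V H → V H → Set
  Adjacent K u x = ∃ λ e → e ∈ ES K × u ∈ ψ H e × x ∈ ψ H e × u ≢ x

  adjacent? : ∀ K u x → Dec (Adjacent K u x)
  adjacent? K u x =
    any? λ e → (e ∈? ES K) ×-dec (u ∈? ψ H e) ×-dec (x ∈? ψ H e) ×-dec ¬? (u ≟ x)

  walk-mono : ∀ {K L : Sub H} {u w} → ES K ⊆ ES L → Walk K u w → Walk L u w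
  walk-mono K⊆L [] = []
  walk-mono K⊆L (step e e∈K u∈e x∈e u≢x p) = step e (K⊆L e∈K) u∈e x∈e u≢x (walk-mono K⊆L p)

  _++ʷ_ : ∀ {K : Sub H} {u x w} → Walk K u x → Walk K x w → Walk K u w
  [] ++ʷ q = q
  step e e∈K u∈e x∈e u≢x p ++ʷ q = step e e∈K u∈e x∈e u≢x (p ++ʷ q)

  reverseʷ : ∀ {K : Sub H} {u w} → Walk K u w → Walk K w u
  reverseʷ [] = []
  reverseʷ (step e e∈K u∈e x∈e u≢x p) = reverseʷ p ++ʷ step e e∈K x∈e u∈e (u≢x ∘ sym) []

  walk-target∈ : ∀ {K : Sub H} {u w} → EdgeClosed K → u ∈ VS K → Walk K u w → w ∈ VS K
  walk-target∈ closed u∈K [] = u∈K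
  walk-target∈ closed u∈K (step e e∈K _ x∈e _ p) = walk-target∈ closed (closed e e∈K x∈e) p

  walk-within : ∀ {K : Sub H} {u w} → Connected K → u ∈ VS K → w ∈ VS K → Walk K u w
  walk-within {u = u} {w} connected u∈K w∈K with u ≟ w
  ... | yes refl = []
  ... | no u≢w = connected u w u∈K w∈K u≢w

  connected-if-reaching : ∀ {K : Sub H} {w} → (∀ {x} → x ∈ VS K → Walk K x w) → Connected K
  connected-if-reaching reach u u′ u∈K u′∈K _ = reach u∈K ++ʷ reverseʷ (reach u′∈K)

  first-edge : ∀ {K : Sub H} {u w} → Walk K u w → u ≢ w → ∃ λ e → e ∈ ES K × u ∈ ψ H e
  first-edge [] u≢u = ⊥-elim (u≢u refl)
  first-edge (step e e∈K u∈e _ _ _) _ = e , e∈K , u∈e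

  edge-through : ∀ {K : Sub H} {x} → Connected K → EdgeClosed K → NoEmptyEdges K → HasEdge K →
            x ∈ VS K → ∃ λ e → e ∈ ES K × x ∈ ψ H e
  edge-through {x = x} connected closed nonempty (e , e∈K) x∈K with nonempty e e∈K
  ... | y , y∈e with x ≟ y
  ...   | yes refl = e , e∈K , y∈e
  ...   | no x≢y = first-edge (connected x y x∈K (closed e e∈K y∈e) x≢y) x≢y

  -- These decision procedures enumerate all subsets; letting the type checker unfold them is
  -- prohibitively slow.
  opaque
    walk? : ∀ (K : Sub H) u w → Dec (Walk K u w)
    walk? K u w with u ≟ w
    ... | yes refl = yes []
    ... | no u≢w = map′ toWalk (λ p → [ ⊥-elim ∘ u≢w , id ]′ (fromWalk p)) (path? (allFin _) u w)
      where
      open Reachability (adjacent? K)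

      toWalk : ∀ {L u w} → Path L u w → Walk K u w
      toWalk (edge (e , e∈K , u∈e , x∈e , u≢x)) = step e e∈K u∈e x∈e u≢x []
      toWalk (via (e , e∈K , u∈e , x∈e , u≢x) _ p) = step e e∈K u∈e x∈e u≢x (toWalk p)

      fromWalk : ∀ {u w} → Walk K u w → u ≡ w ⊎ Path (allFin _) u w
      fromWalk [] = inj₁ refl
      fromWalk (step e e∈K u∈e x∈e u≢x p) with fromWalk p
      ... | inj₁ refl = inj₂ (edge (e , e∈K , u∈e , x∈e , u≢x))
      ... | inj₂ q = inj₂ (via (e , e∈K , u∈e , x∈e , u≢x) (∈-allFin _) q)

    ∃Sub? : {P : Sub H → Set} → (∀ K → Dec (P K)) → Dec (∃ P)
    ∃Sub? P? = map′ (λ (a , b , Pab) → sub a b , Pab) (λ (K , PK) → VS K , ES K , PK)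
                    (anySubset? λ a → anySubset? λ b → P? (sub a b))

    _≤ₛ?_ : (K L : Sub H) → Dec (K ≤ₛ L)
    K ≤ₛ? L = (VS K ⊆? VS L) ×-dec (ES K ⊆? ES L)

    isHypersubgraph? : ∀ K → Dec (IsHypersubgraph H K)
    isHypersubgraph? K =
      nonempty? (VS K) ×-dec all? (λ e → (e ∈? ES K) →-dec (ψ H e ⊆? VS K))

    connected? : ∀ (K : Sub H) → Dec (Connected K)
    connected? K = all? λ u → all? λ w →
      (u ∈? VS K) →-dec (w ∈? VS K) →-dec ¬? (u ≟ w) →-dec walk? K u w

    noEmptyEdges? : ∀ (K : Sub H) → Dec (NoEmptyEdges K)
    noEmptyEdges? K = all? λ e → (e ∈? ES K) →-dec nonempty? (ψ H e)

    separating? : ∀ (K : Sub H) v → Dec (Separating K v)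
    separating? K v = ∃Sub? λ K₁ → ∃Sub? λ K₂ →
      isHypersubgraph? K₁ ×-dec isHypersubgraph? K₂ ×-dec (K₁ ≤ₛ? K) ×-dec (K₂ ≤ₛ? K)
      ×-dec connected? K₁ ×-dec connected? K₂ ×-dec nonempty? (ES K₁) ×-dec nonempty? (ES K₂)
      ×-dec all? (λ e → (e ∈? ES K₁) →-dec (e ∈? ES K₂) →-dec no id)
      ×-dec all? (λ x → (x ∈? VS K) →-dec ((x ∈? VS K₁) ⊎-dec (x ∈? VS K₂)))
      ×-dec all? (λ e → (e ∈? ES K) →-dec ((e ∈? ES K₁) ⊎-dec (e ∈? ES K₂)))
      ×-dec all? (λ x → (x ∈? VS K₁) →-dec (x ∈? VS K₂) →-dec (x ≟ v))
      ×-dec (v ∈? VS K₁) ×-dec (v ∈? VS K₂)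

    nonSeparable? : ∀ (K : Sub H) → Dec (NonSeparable K)
    nonSeparable? K =
      connected? K ×-dec noEmptyEdges? K ×-dec all? λ v → ¬? (separating? K v)

  ≤ₛ-refl : ∀ {K : Sub H} → K ≤ₛ K
  ≤ₛ-refl = id , id

  ≤ₛ-trans : ∀ {K L M : Sub H} → K ≤ₛ L → L ≤ₛ M → K ≤ₛ M
  ≤ₛ-trans (V⊆ , E⊆) (V⊆′ , E⊆′) = V⊆′ ∘ V⊆ , E⊆′ ∘ E⊆

  ≤ₛ-whole : ∀ {K : Sub H} → K ≤ₛ whole H
  ≤ₛ-whole = (λ _ → ∈⊤) , (λ _ → ∈⊤)

  ≤ₛ-antisym : ∀ {K L : Sub H} → K ≤ₛ L → L ≤ₛ K → VS K ≡ VS L × ES K ≡ ES L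
  ≤ₛ-antisym (V⊆ , E⊆) (V⊇ , E⊇) = ⊆-antisym V⊆ V⊇ , ⊆-antisym E⊆ E⊇

  _∩ₛ_ : Sub H → Sub H → Sub H
  K ∩ₛ L = sub (VS K ∩ VS L) (ES K ∩ ES L)

  _∪ₛ_ : Sub H → Sub H → Sub H
  K ∪ₛ L = sub (VS K ∪ VS L) (ES K ∪ ES L)

  ∩ₛ-closed : ∀ {K L : Sub H} → EdgeClosed K → EdgeClosed L → EdgeClosed (K ∩ₛ L)
  ∩ₛ-closed {K} {L} K-closed L-closed e e∈K∩L x∈e with x∈p∩q⁻ (ES K) (ES L) e∈K∩L
  ... | e∈K , e∈L = x∈p∩q⁺ (K-closed e e∈K x∈e , L-closed e e∈L x∈e)

  ∪ₛ-closed : ∀ {K L : Sub H} → EdgeClosed K → EdgeClosed L → EdgeClosed (K ∪ₛ L)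
  ∪ₛ-closed {K} {L} K-closed L-closed e e∈K∪L x∈e =
    x∈p∪q⁺ (Sum.map (λ e∈K → K-closed e e∈K x∈e) (λ e∈L → L-closed e e∈L x∈e)
                    (x∈p∪q⁻ (ES K) (ES L) e∈K∪L))

  ∪ₛ-least : ∀ {K L M : Sub H} → K ≤ₛ M → L ≤ₛ M → (K ∪ₛ L) ≤ₛ M
  ∪ₛ-least {K} {L} (KV , KE) (LV , LE) =
    [ KV , LV ]′ ∘ x∈p∪q⁻ (VS K) (VS L) , [ KE , LE ]′ ∘ x∈p∪q⁻ (ES K) (ES L)

  noEmptyEdges-sub : NoEmptyEdges (whole H) → ∀ (K : Sub H) → NoEmptyEdges K
  noEmptyEdges-sub nonempty K e _ = nonempty e ∈⊤

  record Separation (K : Sub H) (v : V H) : Set where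
    constructor mkSeparation
    field
      K₁ K₂         : Sub H
      K₁-sub        : IsHypersubgraph H K₁
      K₂-sub        : IsHypersubgraph H K₂
      K₁≤K          : K₁ ≤ₛ K
      K₂≤K          : K₂ ≤ₛ K
      K₁-connected  : Connected K₁
      K₂-connected  : Connected K₂
      K₁-edge       : HasEdge K₁
      K₂-edge       : HasEdge K₂
      edge-disjoint : ∀ e → e ∈ ES K₁ → e ∈ ES K₂ → ⊥
      vertex-cover  : ∀ x → x ∈ VS K → x ∈ VS K₁ ⊎ x ∈ VS K₂
      edge-cover    : ∀ e → e ∈ ES K → e ∈ ES K₁ ⊎ e ∈ ES K₂
      meet          : ∀ x → x ∈ VS K₁ → x ∈ VS K₂ → x ≡ v
      cut∈K₁        : v ∈ VS K₁
      cut∈K₂        : v ∈ VS K₂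

    K₁-closed : EdgeClosed K₁
    K₁-closed = proj₂ K₁-sub

    K₂-closed : EdgeClosed K₂
    K₂-closed = proj₂ K₂-sub

  open Separation

  fromSeparating : ∀ {K v} → Separating K v → Separation K v
  fromSeparating (a , b , c , d , e , f , g , h , i , j , k , l , m , n , o , p) =
    mkSeparation a b c d e f g h i j k l m n o p

  toSeparating : ∀ {K v} → Separation K v → Separating K v
  toSeparating (mkSeparation a b c d e f g h i j k l m n o p) =
    a , b , c , d , e , f , g , h , i , j , k , l , m , n , o , p

  swap : ∀ {K v} → Separation K v → Separation K v
  swap sp = record
    { K₁ = K₂ sp ; K₂ = K₁ sp
    ; K₁-sub = K₂-sub sp ; K₂-sub = K₁-sub sp
    ; K₁≤K = K₂≤K sp ; K₂≤K = K₁≤K sp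
    ; K₁-connected = K₂-connected sp ; K₂-connected = K₁-connected sp
    ; K₁-edge = K₂-edge sp ; K₂-edge = K₁-edge sp
    ; edge-disjoint = λ e e∈K₂ e∈K₁ → edge-disjoint sp e e∈K₁ e∈K₂
    ; vertex-cover = λ x → Sum.swap ∘ vertex-cover sp x
    ; edge-cover = λ e → Sum.swap ∘ edge-cover sp e
    ; meet = λ x x∈K₂ x∈K₁ → meet sp x x∈K₁ x∈K₂
    ; cut∈K₁ = cut∈K₂ sp ; cut∈K₂ = cut∈K₁ sp
    }

  -- The first edge of the walk outside K₁ lies in K₂, so it starts at the cut vertex w.
  walk-to-cut : ∀ {M K : Sub H} {w x z} (sp : Separation M w) → EdgeClosed K → ES K ⊆ ES M →
                x ∈ VS K → x ∈ VS (K₁ sp) → z ∈ VS (K₂ sp) → Walk K x z → Walk (K ∩ₛ K₁ sp) x w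
  walk-to-cut {K = K} sp _ _ _ x∈K₁ z∈K₂ [] = subst (Walk (K ∩ₛ K₁ sp) _) (meet sp _ x∈K₁ z∈K₂) []
  walk-to-cut {K = K} sp K-closed K⊆M x∈K x∈K₁ z∈K₂ (step e e∈K x∈e y∈e x≢y p)
    with edge-cover sp e (K⊆M e∈K)
  ... | inj₁ e∈K₁ = step e (x∈p∩q⁺ (e∈K , e∈K₁)) x∈e y∈e x≢y
          (walk-to-cut sp K-closed K⊆M (K-closed e e∈K y∈e) (K₁-closed sp e e∈K₁ y∈e) z∈K₂ p)
  ... | inj₂ e∈K₂ = subst (Walk (K ∩ₛ K₁ sp) _) (meet sp _ x∈K₁ (K₂-closed sp e e∈K₂ x∈e)) []

  module _ {M K : Sub H} {w : V H} (K-connected : Connected K) (K-closed : EdgeClosed K)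
           (K-nonempty : NoEmptyEdges K) (K≤M : K ≤ₛ M) where

    restriction-reaches-cut : ∀ {a} (sp : Separation M w) → a ∈ ES K → a ∈ ES (K₂ sp) →
                         ∀ {x} → x ∈ VS (K ∩ₛ K₁ sp) → Walk (K ∩ₛ K₁ sp) x w
    restriction-reaches-cut {a} sp a∈K a∈K₂ x∈K∩K₁
      with x∈p∩q⁻ (VS K) (VS (K₁ sp)) x∈K∩K₁ | K-nonempty a a∈K
    ... | x∈K , x∈K₁ | z , z∈a =
      walk-to-cut sp K-closed (proj₂ K≤M) x∈K x∈K₁ (K₂-closed sp a a∈K₂ z∈a)
        (walk-within K-connected x∈K (K-closed a a∈K z∈a))

    cut∈restriction : ∀ {a b} (sp : Separation M w) → a ∈ ES K → a ∈ ES (K₂ sp) →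
                      b ∈ ES K → b ∈ ES (K₁ sp) → w ∈ VS (K ∩ₛ K₁ sp)
    cut∈restriction sp a∈K a∈K₂ b∈K b∈K₁ with K-nonempty _ b∈K
    ... | y , y∈b = walk-target∈ (∩ₛ-closed K-closed (K₁-closed sp)) y∈K∩K₁
                      (restriction-reaches-cut sp a∈K a∈K₂ y∈K∩K₁)
      where y∈K∩K₁ = x∈p∩q⁺ (K-closed _ b∈K y∈b , K₁-closed sp _ b∈K₁ y∈b)

    restrict : ∀ {a b} (sp : Separation M w) → a ∈ ES K → a ∈ ES (K₁ sp) →
               b ∈ ES K → b ∈ ES (K₂ sp) → Separation K w
    restrict {a} {b} sp a∈K a∈K₁ b∈K b∈K₂ = record
      { K₁ = K ∩ₛ K₁ sp
      ; K₂ = K ∩ₛ K₂ sp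
      ; K₁-sub = (w , w∈K∩K₁) , ∩ₛ-closed K-closed (K₁-closed sp)
      ; K₂-sub = (w , w∈K∩K₂) , ∩ₛ-closed K-closed (K₂-closed sp)
      ; K₁≤K = p∩q⊆p _ _ , p∩q⊆p _ _
      ; K₂≤K = p∩q⊆p _ _ , p∩q⊆p _ _
      ; K₁-connected = connected-if-reaching (restriction-reaches-cut sp b∈K b∈K₂)
      ; K₂-connected = connected-if-reaching (restriction-reaches-cut (swap sp) a∈K a∈K₁)
      ; K₁-edge = a , x∈p∩q⁺ (a∈K , a∈K₁)
      ; K₂-edge = b , x∈p∩q⁺ (b∈K , b∈K₂)
      ; edge-disjoint = λ e e∈₁ e∈₂ →
          edge-disjoint sp e (p∩q⊆q _ _ e∈₁) (p∩q⊆q _ _ e∈₂)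
      ; vertex-cover = λ x x∈K → ∈-∩-split x∈K (vertex-cover sp x (proj₁ K≤M x∈K))
      ; edge-cover = λ e e∈K → ∈-∩-split e∈K (edge-cover sp e (proj₂ K≤M e∈K))
      ; meet = λ x x∈₁ x∈₂ → meet sp x (p∩q⊆q _ _ x∈₁) (p∩q⊆q _ _ x∈₂)
      ; cut∈K₁ = w∈K∩K₁
      ; cut∈K₂ = w∈K∩K₂
      }
      where
      w∈K∩K₁ = cut∈restriction sp b∈K b∈K₂ a∈K a∈K₁
      w∈K∩K₂ = cut∈restriction (swap sp) a∈K a∈K₁ b∈K b∈K₂

  edge-in-K₂ : ∀ {M w e} (sp : Separation M w) → e ∈ ES M → e ∉ ES (K₁ sp) → e ∈ ES (K₂ sp)
  edge-in-K₂ sp e∈M e∉K₁ = [ ⊥-elim ∘ e∉K₁ , id ]′ (edge-cover sp _ e∈M)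

  nonSeparable-within-part : ∀ {K M : Sub H} {w} → IsHypersubgraph H K → NonSeparable K →
                             K ≤ₛ M → (sp : Separation M w) → ES K ⊆ ES (K₁ sp) ⊎ ES K ⊆ ES (K₂ sp)
  nonSeparable-within-part {K} (_ , K-closed) (K-connected , K-nonempty , K-nonsep) K≤M@(_ , K⊆M) sp
    with ⊆⊎∃∉ (ES K) (ES (K₁ sp)) | ⊆⊎∃∉ (ES K) (ES (K₂ sp))
  ... | inj₁ K⊆K₁ | _ = inj₁ K⊆K₁
  ... | inj₂ _ | inj₁ K⊆K₂ = inj₂ K⊆K₂
  ... | inj₂ (a , a∈K , a∉K₁) | inj₂ (b , b∈K , b∉K₂) =
    ⊥-elim (K-nonsep _ (toSeparating (restrict K-connected K-closed K-nonempty K≤M sp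
      b∈K (edge-in-K₂ (swap sp) (K⊆M b∈K) b∉K₂) a∈K (edge-in-K₂ sp (K⊆M a∈K) a∉K₁))))

  -- The other part K₂ sp is attached, at w, to the piece of K₁ sp that contains w.
  glue-at : ∀ {M : Sub H} {w v} (sp : Separation M w) (sq : Separation (K₁ sp) v) →
            w ∈ VS (K₁ sq) → Separation M v
  glue-at {M} {w} {v} sp sq w∈S₁ = record
    { K₁ = K₁ sq ∪ₛ K₂ sp
    ; K₂ = K₂ sq
    ; K₁-sub = (v , x∈p∪q⁺ (inj₁ (cut∈K₁ sq))) , ∪ₛ-closed (K₁-closed sq) (K₂-closed sp)
    ; K₂-sub = K₂-sub sq
    ; K₁≤K = ∪ₛ-least (≤ₛ-trans (K₁≤K sq) (K₁≤K sp)) (K₂≤K sp)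
    ; K₂≤K = ≤ₛ-trans (K₂≤K sq) (K₁≤K sp)
    ; K₁-connected = connected-if-reaching reach-w
    ; K₂-connected = K₂-connected sq
    ; K₁-edge = proj₁ (K₁-edge sq) , x∈p∪q⁺ (inj₁ (proj₂ (K₁-edge sq)))
    ; K₂-edge = K₂-edge sq
    ; edge-disjoint = λ e e∈S₁∪T e∈S₂ →
        [ (λ e∈S₁ → edge-disjoint sq e e∈S₁ e∈S₂) , edge-disjoint sp e (proj₂ (K₂≤K sq) e∈S₂) ]′
          (x∈p∪q⁻ (ES (K₁ sq)) (ES (K₂ sp)) e∈S₁∪T)
    ; vertex-cover = λ x x∈M → regroup-∪ (vertex-cover sq x) (vertex-cover sp x x∈M)
    ; edge-cover = λ e e∈M → regroup-∪ (edge-cover sq e) (edge-cover sp e e∈M)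
    ; meet = meet-at-v
    ; cut∈K₁ = x∈p∪q⁺ (inj₁ (cut∈K₁ sq))
    ; cut∈K₂ = cut∈K₂ sq
    }
    where
    reach-w : ∀ {x} → x ∈ VS (K₁ sq ∪ₛ K₂ sp) → Walk (K₁ sq ∪ₛ K₂ sp) x w
    reach-w x∈S₁∪T with x∈p∪q⁻ (VS (K₁ sq)) (VS (K₂ sp)) x∈S₁∪T
    ... | inj₁ x∈S₁ = walk-mono (p⊆p∪q _) (walk-within (K₁-connected sq) x∈S₁ w∈S₁)
    ... | inj₂ x∈T = walk-mono (q⊆p∪q _ _) (walk-within (K₂-connected sp) x∈T (cut∈K₂ sp))

    meet-at-v : ∀ x → x ∈ VS (K₁ sq ∪ₛ K₂ sp) → x ∈ VS (K₂ sq) → x ≡ v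
    meet-at-v x x∈S₁∪T x∈S₂ with x∈p∪q⁻ (VS (K₁ sq)) (VS (K₂ sp)) x∈S₁∪T
    ... | inj₁ x∈S₁ = meet sq x x∈S₁ x∈S₂
    ... | inj₂ x∈T with meet sp x (proj₁ (K₂≤K sq) x∈S₂) x∈T
    ...   | refl = meet sq x w∈S₁ x∈S₂

  glue : ∀ {M : Sub H} {w v} (sp : Separation M w) → Separation (K₁ sp) v → Separation M v
  glue sp sq with vertex-cover sq _ (cut∈K₁ sp)
  ... | inj₁ w∈S₁ = glue-at sp sq w∈S₁
  ... | inj₂ w∈S₂ = glue-at sp (swap sq) w∈S₂

  part-fewer-edges : ∀ {M w} (sp : Separation M w) → ∣ ES (K₁ sp) ∣ < ∣ ES M ∣
  part-fewer-edges sp with K₂-edge sp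
  ... | f , f∈K₂ = p⊂q⇒∣p∣<∣q∣
    (proj₂ (K₁≤K sp) , f , proj₂ (K₂≤K sp) f∈K₂ , λ f∈K₁ → edge-disjoint sp f f∈K₁ f∈K₂)

  edgeless-singleton : ∀ {K : Sub H} {u w} → Connected K → ¬ HasEdge K → u ∈ VS K → w ∈ VS K → u ≡ w
  edgeless-singleton {u = u} {w} connected edgeless u∈K w∈K = decidable-stable (u ≟ w) λ u≢w →
    edgeless (map₂ proj₁ (first-edge (connected u w u∈K w∈K u≢w) u≢w))

  ≤ₛ-from-edges : ∀ {K L : Sub H} → Connected K → EdgeClosed K → NoEmptyEdges K → HasEdge K →
                  EdgeClosed L → ES K ⊆ ES L → K ≤ₛ L
  ≤ₛ-from-edges K-connected K-closed K-nonempty K-edge L-closed K⊆L =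
    (λ x∈K → let (e , e∈K , x∈e) = edge-through K-connected K-closed K-nonempty K-edge x∈K
             in L-closed e (K⊆L e∈K) x∈e) , K⊆L

  edge-sub : E H → Sub H
  edge-sub e = sub (ψ H e) ⁅ e ⁆

  edge-sub-closed : ∀ {e} → EdgeClosed (edge-sub e)
  edge-sub-closed f f∈⁅e⁆ with x∈⁅y⁆⇒x≡y _ f∈⁅e⁆
  ... | refl = id

  edge-sub-nonSeparable : ∀ {e} → Nonempty (ψ H e) → NonSeparable (edge-sub e)
  edge-sub-nonSeparable {e} e-nonempty = connected , nonempty , unseparated
    where
    connected : Connected (edge-sub e)
    connected u w u∈e w∈e u≢w = step e (x∈⁅x⁆ e) u∈e w∈e u≢w []

    nonempty : NoEmptyEdges (edge-sub e)
    nonempty f f∈⁅e⁆ with x∈⁅y⁆⇒x≡y _ f∈⁅e⁆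
    ... | refl = e-nonempty

    only-edge : ∀ {K} → HasEdge K → K ≤ₛ edge-sub e → e ∈ ES K
    only-edge (f , f∈K) (_ , K⊆⁅e⁆) with x∈⁅y⁆⇒x≡y e (K⊆⁅e⁆ f∈K)
    ... | refl = f∈K

    unseparated : ∀ v → ¬ Separating (edge-sub e) v
    unseparated v separating = edge-disjoint sp e
      (only-edge (K₁-edge sp) (K₁≤K sp)) (only-edge (K₂-edge sp) (K₂≤K sp))
      where sp = fromSeparating separating

  -- cosize shrinks under proper enlargement, so minimising it yields maximal elements.
  cosize : Sub H → ℕ
  cosize K = ∣ ∁ (VS K) ∣ + ∣ ∁ (ES K) ∣

  cosize-decreasing : ∀ {K L : Sub H} → K ≤ₛ L → ¬ L ≤ₛ K → cosize L < cosize K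
  cosize-decreasing (V⊆ , E⊆) L≰K with ⊆⊎∃∉ _ _ | ⊆⊎∃∉ _ _
  ... | inj₁ V⊇ | inj₁ E⊇ = ⊥-elim (L≰K (V⊇ , E⊇))
  ... | inj₂ x∈L∖K | _ =
    +-mono-<-≤ (p⊂q⇒∣p∣<∣q∣ (p⊂q⇒∁p⊃∁q (V⊆ , x∈L∖K))) (p⊆q⇒∣p∣≤∣q∣ (p⊆q⇒∁p⊇∁q E⊆))
  ... | inj₁ _ | inj₂ e∈L∖K =
    +-mono-≤-< (p⊆q⇒∣p∣≤∣q∣ (p⊆q⇒∁p⊇∁q V⊆)) (p⊂q⇒∣p∣<∣q∣ (p⊂q⇒∁p⊃∁q (E⊆ , e∈L∖K)))

  NonSeparableAbove : Sub H → Sub H → Set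
  NonSeparableAbove S K = IsHypersubgraph H K × NonSeparable K × S ≤ₛ K

  nonSeparableAbove? : ∀ S K → Dec (NonSeparableAbove S K)
  nonSeparableAbove? S K = isHypersubgraph? K ×-dec nonSeparable? K ×-dec (S ≤ₛ? K)

  block-containing : ∀ {S : Sub H} → IsHypersubgraph H S → NonSeparable S →
                     ∃ λ B → IsBlock H B × S ≤ₛ B
  block-containing {S} S-sub S-nonsep
    with μ-minimal cosize (λ B → ∃Sub? λ K → nonSeparableAbove? S K ×-dec (cosize K <? cosize B))
                   (S-sub , S-nonsep , ≤ₛ-refl)
  ... | B , (B-sub , B-nonsep , S≤B) , least = B , (B-sub , B-nonsep , maximal) , S≤B
    where
    maximal : ∀ K → IsHypersubgraph H K → NonSeparable K → B ≤ₛ K → K ≤ₛ B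
    maximal K K-sub K-nonsep B≤K = decidable-stable (K ≤ₛ? B) λ K≰B →
      <⇒≱ (cosize-decreasing B≤K K≰B) (least K (K-sub , K-nonsep , ≤ₛ-trans S≤B B≤K))

  block-through-edge : ∀ {e} → Nonempty (ψ H e) → ∃ λ B → IsBlock H B × edge-sub e ≤ₛ B
  block-through-edge e-nonempty =
    block-containing (e-nonempty , edge-sub-closed) (edge-sub-nonSeparable e-nonempty)

  -- An edgeless block is a single vertex, properly contained in any edge through it.
  block-hasEdge : ∀ {B : Sub H} {v e} → IsBlock H B → v ∈ VS B → v ∈ ψ H e → HasEdge B
  block-hasEdge {B} {v} {e} (_ , (B-connected , _) , B-maximal) v∈B v∈e =
    decidable-stable (nonempty? (ES B)) λ edgeless →
      let B≤e : B ≤ₛ edge-sub e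
          B≤e = (λ u∈B → subst (_∈ ψ H e) (sym (edgeless-singleton B-connected edgeless u∈B v∈B)) v∈e)
              , (λ f∈B → ⊥-elim (edgeless (_ , f∈B)))
          e≤B = B-maximal (edge-sub e) ((v , v∈e) , edge-sub-closed)
                  (edge-sub-nonSeparable (v , v∈e)) B≤e
      in edgeless (e , proj₂ e≤B (x∈⁅x⁆ e))

  block-≤ₛ : ∀ {B L : Sub H} → IsBlock H B → HasEdge B → EdgeClosed L → ES B ⊆ ES L → B ≤ₛ L
  block-≤ₛ ((_ , B-closed) , (B-connected , B-nonempty , _) , _) =
    ≤ₛ-from-edges B-connected B-closed B-nonempty

  separating⇒inTwoBlocks : ∀ {v} → NoEmptyEdges (whole H) → Separating (whole H) v →
                           InMoreThanOneBlock H v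
  separating⇒inTwoBlocks {v} nonempty separating =
    blocks-at (edge-through-cut sp) (edge-through-cut (swap sp))
    where
    sp = fromSeparating separating

    edge-through-cut : (sp : Separation (whole H) v) → ∃ λ e → e ∈ ES (K₁ sp) × v ∈ ψ H e
    edge-through-cut sp = edge-through (K₁-connected sp) (K₁-closed sp)
      (noEmptyEdges-sub nonempty (K₁ sp)) (K₁-edge sp) (cut∈K₁ sp)

    blocks-at : (∃ λ e → e ∈ ES (K₁ sp) × v ∈ ψ H e) → (∃ λ e → e ∈ ES (K₂ sp) × v ∈ ψ H e) →
                InMoreThanOneBlock H v
    blocks-at (e₁ , e₁∈K₁ , v∈e₁) (e₂ , e₂∈K₂ , v∈e₂)
      with block-through-edge (v , v∈e₁) | block-through-edge (v , v∈e₂)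
    ... | B₁ , B₁-block@(B₁-sub , B₁-nonsep , _) , e₁≤B₁ | B₂ , B₂-block , e₂≤B₂ =
      B₁ , B₂ , B₁-block , B₂-block , distinct , proj₁ e₁≤B₁ v∈e₁ , proj₁ e₂≤B₂ v∈e₂
      where
      distinct : Distinct B₁ B₂
      distinct (_ , E≡) with nonSeparable-within-part B₁-sub B₁-nonsep ≤ₛ-whole sp
      ... | inj₁ B₁⊆K₁ = edge-disjoint sp e₂
              (B₁⊆K₁ (subst (e₂ ∈_) (sym E≡) (proj₂ e₂≤B₂ (x∈⁅x⁆ e₂)))) e₂∈K₂
      ... | inj₂ B₁⊆K₂ = edge-disjoint sp e₁ e₁∈K₁ (B₁⊆K₂ (proj₂ e₁≤B₁ (x∈⁅x⁆ e₁)))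

  module _ {v : V H} {B₁ B₂ : Sub H} (nonempty : NoEmptyEdges (whole H))
           (B₁-block : IsBlock H B₁) (B₂-block : IsBlock H B₂)
           (v∈B₁ : v ∈ VS B₁) (v∈B₂ : v ∈ VS B₂)
           (B₁-edge : HasEdge B₁) (B₂-edge : HasEdge B₂) where

    Encloses : Sub H → Set
    Encloses M = IsHypersubgraph H M × Connected M × B₁ ≤ₛ M × B₂ ≤ₛ M × ¬ Separating M v

    encloses? : ∀ M → Dec (Encloses M)
    encloses? M = isHypersubgraph? M ×-dec connected? M ×-dec (B₁ ≤ₛ? M) ×-dec (B₂ ≤ₛ? M)
                  ×-dec ¬? (separating? M v)

    part-encloses : ∀ {M w} → Encloses M → (sp : Separation M w) →
                    ES B₁ ⊆ ES (K₁ sp) → ES B₂ ⊆ ES (K₁ sp) → Encloses (K₁ sp)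
    part-encloses (_ , _ , _ , _ , v-nonsep) sp B₁⊆K₁ B₂⊆K₁ =
      K₁-sub sp , K₁-connected sp , block-≤ₛ B₁-block B₁-edge (K₁-closed sp) B₁⊆K₁ ,
      block-≤ₛ B₂-block B₂-edge (K₁-closed sp) B₂⊆K₁ ,
      λ separating → v-nonsep (toSeparating (glue sp (fromSeparating separating)))

    cut-at-v : ∀ {M w} (sp : Separation M w) → ES B₁ ⊆ ES (K₁ sp) → ES B₂ ⊆ ES (K₂ sp) → w ≡ v
    cut-at-v sp B₁⊆K₁ B₂⊆K₂ = sym (meet sp _
      (proj₁ (block-≤ₛ B₁-block B₁-edge (K₁-closed sp) B₁⊆K₁) v∈B₁)
      (proj₁ (block-≤ₛ B₂-block B₂-edge (K₂-closed sp) B₂⊆K₂) v∈B₂))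

    shrink : ∀ {M w} → Encloses M → Separation M w →
             ∃ λ M′ → Encloses M′ × ∣ ES M′ ∣ < ∣ ES M ∣
    shrink {w = w} enc@(_ , _ , B₁≤M , B₂≤M , v-nonsep) sp with w ≟ v
    ... | yes refl = ⊥-elim (v-nonsep (toSeparating sp))
    ... | no w≢v
      with nonSeparable-within-part (proj₁ B₁-block) (proj₁ (proj₂ B₁-block)) B₁≤M sp
         | nonSeparable-within-part (proj₁ B₂-block) (proj₁ (proj₂ B₂-block)) B₂≤M sp
    ... | inj₁ B₁⊆K₁ | inj₁ B₂⊆K₁ = _ , part-encloses enc sp B₁⊆K₁ B₂⊆K₁ , part-fewer-edges sp
    ... | inj₂ B₁⊆K₂ | inj₂ B₂⊆K₂ =
      _ , part-encloses enc (swap sp) B₁⊆K₂ B₂⊆K₂ , part-fewer-edges (swap sp)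
    ... | inj₁ B₁⊆K₁ | inj₂ B₂⊆K₂ = ⊥-elim (w≢v (cut-at-v sp B₁⊆K₁ B₂⊆K₂))
    ... | inj₂ B₁⊆K₂ | inj₁ B₂⊆K₁ = ⊥-elim (w≢v (cut-at-v (swap sp) B₁⊆K₂ B₂⊆K₁))

    least-enclosing-nonSeparable : ∀ {M} → Encloses M →
      (∀ M′ → Encloses M′ → ∣ ES M ∣ ≤ ∣ ES M′ ∣) → NonSeparable M
    least-enclosing-nonSeparable {M} enc@(_ , M-connected , _) least =
      M-connected , noEmptyEdges-sub nonempty M , λ w separating →
        let (M′ , enc′ , fewer) = shrink enc (fromSeparating separating)
        in <⇒≱ fewer (least M′ enc′)

    enclosed-blocks-equal : ∀ {M} → Encloses M → VS B₁ ≡ VS B₂ × ES B₁ ≡ ES B₂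
    enclosed-blocks-equal enc
      with μ-minimal (∣_∣ ∘ ES) (λ M → ∃Sub? λ M′ → encloses? M′ ×-dec (∣ ES M′ ∣ <? ∣ ES M ∣)) enc
    ... | M , least-enc@(M-sub , _ , B₁≤M , B₂≤M , _) , least =
      ≤ₛ-antisym (≤ₛ-trans B₁≤M (M≤ B₂-block B₂≤M)) (≤ₛ-trans B₂≤M (M≤ B₁-block B₁≤M))
      where
      M≤ : ∀ {B} → IsBlock H B → B ≤ₛ M → M ≤ₛ B
      M≤ (_ , _ , B-maximal) = B-maximal M M-sub (least-enclosing-nonSeparable least-enc least)

  isolated⇒subs-equal : ∀ {v} → Connected (whole H) → NoEmptyEdges (whole H) →
                          ¬ (∃ λ e → v ∈ ψ H e) → ∀ {K L : Sub H} → v ∈ VS K → v ∈ VS L →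
                          VS K ≡ VS L × ES K ≡ ES L
  isolated⇒subs-equal {v} connected nonempty isolated v∈K v∈L = ≤ₛ-antisym (≤ₛ-at v∈L) (≤ₛ-at v∈K)
    where
    only-v : ∀ u → u ≡ v
    only-v u = decidable-stable (u ≟ v) λ u≢v →
      isolated (map₂ proj₂ (first-edge (connected v u ∈⊤ ∈⊤ (u≢v ∘ sym)) (u≢v ∘ sym)))

    ≤ₛ-at : ∀ {K L : Sub H} → v ∈ VS L → K ≤ₛ L
    ≤ₛ-at v∈L = (λ {u} _ → subst (_∈ _) (sym (only-v u)) v∈L) , λ {e} _ →
      let (x , x∈e) = nonempty e ∈⊤ in ⊥-elim (isolated (e , subst (_∈ ψ H e) (only-v x) x∈e))

  inTwoBlocks⇒separating : ∀ {v} → Connected (whole H) → NoEmptyEdges (whole H) →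
                           InMoreThanOneBlock H v → Separating (whole H) v
  inTwoBlocks⇒separating {v} connected nonempty
                         (B₁ , B₂ , B₁-block , B₂-block , distinct , v∈B₁ , v∈B₂) =
    decidable-stable (separating? (whole H) v) λ v-nonsep → distinct (blocks-equal v-nonsep)
    where
    blocks-equal : ¬ Separating (whole H) v → VS B₁ ≡ VS B₂ × ES B₁ ≡ ES B₂
    blocks-equal v-nonsep with any? (λ e → v ∈? ψ H e)
    ... | yes (e , v∈e) =
      enclosed-blocks-equal nonempty B₁-block B₂-block v∈B₁ v∈B₂
        (block-hasEdge B₁-block v∈B₁ v∈e) (block-hasEdge B₂-block v∈B₂ v∈e)
        (((v , ∈⊤) , λ _ _ _ → ∈⊤) , connected , ≤ₛ-whole , ≤ₛ-whole , v-nonsep)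
    ... | no isolated = isolated⇒subs-equal connected nonempty isolated v∈B₁ v∈B₂

theorem3p39 : (H : Hypergraph) → Connected (whole H) → NoEmptyEdges (whole H) →
    (v : V H) → (Separating (whole H) v → InMoreThanOneBlock H v)
              × (InMoreThanOneBlock H v → Separating (whole H) v)
theorem3p39 H connected nonempty v =
  separating⇒inTwoBlocks nonempty , inTwoBlocks⇒separating connected nonempty
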